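{- Let $h,n\ge 2$. If every subgroup of $S_h\times S_n$ is a symmetry group with respect to $(h,n)$, then $\gcd(h,n!)=1$.
   Context: Let $G=S_h\times S_n$, $\mathcal P=(S_n)^h$, with $G$ acting on $\mathcal P$: $p^{(\varphi,\psi)}$ has $i$-th component $\psi\,p_{\varphi^{ -1}(i)}$ (products are compositions). An SPF is a map $F:\mathcal P\to S_n$; its symmetry group is $G(F)=\{(\varphi,\psi)\in G:F(p^{(\varphi,\psi)})=\psi F(p)\ \forall p\in\mathcal P\}$. $U\le G$ is a symmetry group w.r.t. $(h,n)$ if $U=G(F)$ for some SPF $F$. -}

module Defs where

open import Data.Nat.Base using (ℕ)
open import Data.Fin.Base using (Fin)
open import Data.Product.Base using (_×_; _,_; proj₁; proj₂; Σ)
open import Function.Bundles using (_⇔_)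
open import Data.Fin.Permutation using (Permutation′; _⟨$⟩ʳ_; _∘ₚ_; flip; id; _≈_)

S : ℕ → Set
S n = Permutation′ n

-- Composition as in the paper: (ψ · σ)(i) = ψ (σ i)  (σ first, then ψ).
infixr 9 _·_
_·_ : ∀ {n} → S n → S n → S n
ψ · σ = σ ∘ₚ ψ

_⁻¹ : ∀ {n} → S n → S n
σ ⁻¹ = flip σ

G : ℕ → ℕ → Set
G h n = S h × S n

_≈G_ : ∀ {h n} → G h n → G h n → Set
(φ , ψ) ≈G (φ′ , ψ′) = (φ ≈ φ′) × (ψ ≈ ψ′)

_·G_ : ∀ {h n} → G h n → G h n → G h n
(φ , ψ) ·G (φ′ , ψ′) = (φ · φ′ , ψ · ψ′)

invG : ∀ {h n} → G h n → G h n
invG (φ , ψ) = (φ ⁻¹ , ψ ⁻¹)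

idG : ∀ {h n} → G h n
idG = (id , id)

Profile : ℕ → ℕ → Set
Profile h n = Fin h → S n

_≈P_ : ∀ {h n} → Profile h n → Profile h n → Set
p ≈P q = ∀ i → p i ≈ q i

act : ∀ {h n} → Profile h n → G h n → Profile h n
act p (φ , ψ) i = ψ · p ((φ ⁻¹) ⟨$⟩ʳ i)

-- A social preference function: a map P → S_n (a well-defined map on the
-- set of profiles, i.e. respecting extensional equality of permutations).
record SPF (h n : ℕ) : Set where
  field
    F    : Profile h n → S n
    F-cong : ∀ {p q} → p ≈P q → F p ≈ F q
open SPF public

InSym : ∀ {h n} → SPF h n → G h n → Set
InSym Fr (φ , ψ) = ∀ p → F Fr (act p (φ , ψ)) ≈ ψ · F Fr p

record Subgroup (h n : ℕ) : Set₁ where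
  field
    _∈U_    : G h n → Set
    ∈-resp  : ∀ {g g′} → g ≈G g′ → _∈U_ g → _∈U_ g′
    ∈-id    : _∈U_ idG
    ∈-mul   : ∀ {g g′} → _∈U_ g → _∈U_ g′ → _∈U_ (g ·G g′)
    ∈-inv   : ∀ {g} → _∈U_ g → _∈U_ (invG g)
open Subgroup public

IsSymmetryGroup : ∀ {h n} → Subgroup h n → Set
IsSymmetryGroup {h} {n} U = Σ (SPF h n) λ Fr → ∀ g → (_∈U_ U g ⇔ InSym Fr g)

-- If a divisor q of h satisfies 1 < q ≤ n, let φ be the h-cycle on the voters and ψ a q-cycle
-- on the alternatives. Since q ∣ h, the profile whose i-th voter ranks by ψ^i is fixed by
-- (φ, ψ); if the whole of S_h × S_n were the symmetry group of some F, then F of that profile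
-- would be fixed by ψ on the left, forcing ψ = id. So h has no divisor in (1, n], and hence
-- is coprime to n!.
module Submission where

open import Defs
open import Data.Nat.Base
open import Data.Nat.Properties using (_<?_; ≤-refl; ≤-trans; n≤1+n; +-comm; +-assoc; +-identityʳ; *-suc)
open import Data.Nat.DivMod
open import Data.Nat.Divisibility
open import Data.Nat.Coprimality using (Coprime; coprime-divisor; coprime⇒gcd≡1)
open import Data.Nat.GCD using (gcd)
open import Data.Nat.Primality using (_Rough_)
open import Data.Fin.Base using (Fin; zero; toℕ; fromℕ<)
open import Data.Fin.Properties using (toℕ-injective; toℕ-fromℕ<; toℕ<n)
open import Data.Fin.Permutation using (permutation; _⟨$⟩ʳ_; _⟨$⟩ˡ_; inverseʳ; id; _≈_)
open import Data.Product.Base using (_,_)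
open import Data.Unit.Base using (⊤; tt)
open import Function.Bundles using (Equivalence)
open import Relation.Nullary using (¬_; yes; no; contradiction)
open import Relation.Binary.PropositionalEquality

[m%d+n]%d≡[m+n]%d : ∀ m n d .{{_ : NonZero d}} → (m % d + n) % d ≡ (m + n) % d
[m%d+n]%d≡[m+n]%d m n d = begin
  (m % d + n) % d           ≡⟨ %-distribˡ-+ (m % d) n d ⟩
  (m % d % d + n % d) % d   ≡⟨ cong (λ x → (x + n % d) % d) (m%n%n≡m%n m d) ⟩
  (m % d + n % d) % d       ≡⟨ %-distribˡ-+ m n d ⟨
  (m + n) % d               ∎
  where open ≡-Reasoning

module Rotation {N k : ℕ} (m≤N : suc k ≤ N) where

  rotate : ℕ → Fin N → Fin N
  rotate a i with toℕ i <? suc k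
  ... | yes _ = fromℕ< (≤-trans (m%n<n (toℕ i + a) (suc k)) m≤N)
  ... | no  _ = i

  toℕ-rotate : ∀ a {i} → toℕ i < suc k → toℕ (rotate a i) ≡ (toℕ i + a) % suc k
  toℕ-rotate a {i} i<m with toℕ i <? suc k
  ... | yes _   = toℕ-fromℕ< _
  ... | no i≮m = contradiction i<m i≮m

  rotate-≮ : ∀ a {i} → ¬ toℕ i < suc k → rotate a i ≡ i
  rotate-≮ a {i} i≮m with toℕ i <? suc k
  ... | yes i<m = contradiction i<m i≮m
  ... | no _    = refl

  rotate-< : ∀ a {i} → toℕ i < suc k → toℕ (rotate a i) < suc k
  rotate-< a {i} i<m = subst (_< suc k) (sym (toℕ-rotate a i<m)) (m%n<n (toℕ i + a) (suc k))

  -- Case analysis kept apart from 'rotate', so that 'with' does not unfold 'rotate' in the goals below.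
  by-position : ∀ {ℓ} {A : Set ℓ} (i : Fin N) → (toℕ i < suc k → A) → (¬ toℕ i < suc k → A) → A
  by-position i inside outside with toℕ i <? suc k
  ... | yes i<m = inside i<m
  ... | no i≮m  = outside i≮m

  rotate-cong : ∀ {a b} → a % suc k ≡ b % suc k → ∀ i → rotate a i ≡ rotate b i
  rotate-cong {a} {b} a≡b i = by-position i inside outside
    where
    open ≡-Reasoning
    inside : toℕ i < suc k → rotate a i ≡ rotate b i
    inside i<m = toℕ-injective (begin
      toℕ (rotate a i)             ≡⟨ toℕ-rotate a i<m ⟩
      (toℕ i + a) % suc k          ≡⟨ cong (_% suc k) (+-comm (toℕ i) a) ⟩
      (a + toℕ i) % suc k          ≡⟨ [m%d+n]%d≡[m+n]%d a (toℕ i) (suc k) ⟨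
      (a % suc k + toℕ i) % suc k  ≡⟨ cong (λ x → (x + toℕ i) % suc k) a≡b ⟩
      (b % suc k + toℕ i) % suc k  ≡⟨ [m%d+n]%d≡[m+n]%d b (toℕ i) (suc k) ⟩
      (b + toℕ i) % suc k          ≡⟨ cong (_% suc k) (+-comm b (toℕ i)) ⟩
      (toℕ i + b) % suc k          ≡⟨ toℕ-rotate b i<m ⟨
      toℕ (rotate b i)             ∎)
    outside : ¬ toℕ i < suc k → rotate a i ≡ rotate b i
    outside i≮m = trans (rotate-≮ a i≮m) (sym (rotate-≮ b i≮m))

  rotate-∘ : ∀ a b i → rotate a (rotate b i) ≡ rotate (b + a) i
  rotate-∘ a b i = by-position i inside outside
    where
    open ≡-Reasoning
    inside : toℕ i < suc k → rotate a (rotate b i) ≡ rotate (b + a) i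
    inside i<m = toℕ-injective (begin
      toℕ (rotate a (rotate b i))        ≡⟨ toℕ-rotate a (rotate-< b i<m) ⟩
      (toℕ (rotate b i) + a) % suc k     ≡⟨ cong (λ x → (x + a) % suc k) (toℕ-rotate b i<m) ⟩
      ((toℕ i + b) % suc k + a) % suc k  ≡⟨ [m%d+n]%d≡[m+n]%d (toℕ i + b) a (suc k) ⟩
      (toℕ i + b + a) % suc k            ≡⟨ cong (_% suc k) (+-assoc (toℕ i) b a) ⟩
      (toℕ i + (b + a)) % suc k          ≡⟨ toℕ-rotate (b + a) i<m ⟨
      toℕ (rotate (b + a) i)             ∎)
    outside : ¬ toℕ i < suc k → rotate a (rotate b i) ≡ rotate (b + a) i
    outside i≮m = begin
      rotate a (rotate b i)  ≡⟨ cong (rotate a) (rotate-≮ b i≮m) ⟩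
      rotate a i             ≡⟨ rotate-≮ a i≮m ⟩
      i                      ≡⟨ rotate-≮ (b + a) i≮m ⟨
      rotate (b + a) i       ∎

  rotate-0 : ∀ i → rotate 0 i ≡ i
  rotate-0 i = by-position i inside (rotate-≮ 0)
    where
    open ≡-Reasoning
    inside : toℕ i < suc k → rotate 0 i ≡ i
    inside i<m = toℕ-injective (begin
      toℕ (rotate 0 i)     ≡⟨ toℕ-rotate 0 i<m ⟩
      (toℕ i + 0) % suc k  ≡⟨ cong (_% suc k) (+-identityʳ (toℕ i)) ⟩
      toℕ i % suc k        ≡⟨ m<n⇒m%n≡m i<m ⟩
      toℕ i                ∎)

  rotate-full-turn : ∀ c i → rotate (c * suc k) i ≡ i
  rotate-full-turn c i = trans (rotate-cong (m*n%n≡0 c (suc k)) i) (rotate-0 i)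

  -- Rotating by a * k undoes rotating by a, as a + a * k = a * (k + 1).
  rotation : ℕ → S N
  rotation a = permutation (rotate a) (rotate (a * k)) undo-right undo-left
    where
    undo-right : ∀ i → rotate a (rotate (a * k) i) ≡ i
    undo-right i = begin
      rotate a (rotate (a * k) i) ≡⟨ rotate-∘ a (a * k) i ⟩
      rotate (a * k + a) i        ≡⟨ cong (λ b → rotate b i) (+-comm (a * k) a) ⟩
      rotate (a + a * k) i        ≡⟨ cong (λ b → rotate b i) (*-suc a k) ⟨
      rotate (a * suc k) i        ≡⟨ rotate-full-turn a i ⟩
      i                           ∎
      where open ≡-Reasoning
    undo-left : ∀ i → rotate (a * k) (rotate a i) ≡ i
    undo-left i = begin
      rotate (a * k) (rotate a i) ≡⟨ rotate-∘ (a * k) a i ⟩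
      rotate (a + a * k) i        ≡⟨ cong (λ b → rotate b i) (*-suc a k) ⟨
      rotate (a * suc k) i        ≡⟨ rotate-full-turn a i ⟩
      i                           ∎
      where open ≡-Reasoning

rotation-1-≉-id : ∀ {N k} (m≤N : 2 + k ≤ N) → ¬ (Rotation.rotation m≤N 1 ≈ id)
rotation-1-≉-id m≤N@(s≤s _) rotation≈id =
  contradiction (trans (sym (Rotation.toℕ-rotate m≤N 1 z<s)) (cong toℕ (rotation≈id zero))) λ ()

symmetry-fixing-profile⇒≈id : ∀ {h n} (Fr : SPF h n) {φ ψ p} →
  InSym Fr (φ , ψ) → act p (φ , ψ) ≈P p → ψ ≈ id
symmetry-fixing-profile⇒≈id Fr {φ} {ψ} {p} symmetric fixed j = begin
  ψ ⟨$⟩ʳ j                         ≡⟨ cong (ψ ⟨$⟩ʳ_) (inverseʳ σ) ⟨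
  ψ ⟨$⟩ʳ (σ ⟨$⟩ʳ (σ ⟨$⟩ˡ j))       ≡⟨ symmetric p (σ ⟨$⟩ˡ j) ⟨
  F Fr (act p (φ , ψ)) ⟨$⟩ʳ (σ ⟨$⟩ˡ j) ≡⟨ F-cong Fr fixed (σ ⟨$⟩ˡ j) ⟩
  σ ⟨$⟩ʳ (σ ⟨$⟩ˡ j)                ≡⟨ inverseʳ σ ⟩
  j                                ∎
  where
  open ≡-Reasoning
  σ = F Fr p

module CyclicProfile {h′ n k : ℕ} (q≤n : suc k ≤ n) (q∣h : suc k ∣ suc h′) where
  open Rotation

  voterCycle : S (suc h′)
  voterCycle = rotation {suc h′} ≤-refl 1

  alternativeCycle : ℕ → S n
  alternativeCycle = rotation q≤n

  cyclicProfile : Profile (suc h′) n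
  cyclicProfile i = alternativeCycle (toℕ i)

  private
    h = suc h′
    q = suc k

    preceding-voter-% : ∀ i → (toℕ ((voterCycle ⁻¹) ⟨$⟩ʳ i) + 1) % q ≡ toℕ i % q
    preceding-voter-% i = begin
      (toℕ (rotate ≤-refl (1 * h′) i) + 1) % q ≡⟨ cong (λ x → (x + 1) % q) (toℕ-rotate ≤-refl (1 * h′) (toℕ<n i)) ⟩
      ((toℕ i + 1 * h′) % h + 1) % q           ≡⟨ [m%d+n]%d≡[m+n]%d ((toℕ i + 1 * h′) % h) 1 q ⟨
      ((toℕ i + 1 * h′) % h % q + 1) % q       ≡⟨ cong (λ x → (x + 1) % q) (m∣n⇒o%n%m≡o%m q h (toℕ i + 1 * h′) q∣h) ⟩
      ((toℕ i + 1 * h′) % q + 1) % q           ≡⟨ [m%d+n]%d≡[m+n]%d (toℕ i + 1 * h′) 1 q ⟩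
      (toℕ i + 1 * h′ + 1) % q                 ≡⟨ cong (_% q) (+-assoc (toℕ i) (1 * h′) 1) ⟩
      (toℕ i + (h′ + 0 + 1)) % q               ≡⟨ cong (λ x → (toℕ i + (x + 1)) % q) (+-identityʳ h′) ⟩
      (toℕ i + (h′ + 1)) % q                   ≡⟨ cong (λ x → (toℕ i + x) % q) (+-comm h′ 1) ⟩
      (toℕ i + h) % q                          ≡⟨ %-remove-+ʳ (toℕ i) q∣h ⟩
      toℕ i % q                                ∎
      where open ≡-Reasoning

  cyclicProfile-invariant : act cyclicProfile (voterCycle , alternativeCycle 1) ≈P cyclicProfile
  cyclicProfile-invariant i j = trans (rotate-∘ q≤n 1 _ j) (rotate-cong q≤n (preceding-voter-% i) j)

fullSymmetry⇒rough : ∀ {h′ n} (Fr : SPF (suc h′) n) → (∀ g → InSym Fr g) → suc n Rough suc h′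
fullSymmetry⇒rough Fr fullSymmetry (hasNonTrivialDivisor {{()}} z<s _)
fullSymmetry⇒rough Fr fullSymmetry (hasNonTrivialDivisor {{()}} (s<s z<s) _)
fullSymmetry⇒rough Fr fullSymmetry (hasNonTrivialDivisor {2+ k} (s≤s q≤n) q∣h) =
  rotation-1-≉-id q≤n (symmetry-fixing-profile⇒≈id Fr {voterCycle} {ψ} {cyclicProfile}
    (fullSymmetry (voterCycle , ψ)) cyclicProfile-invariant)
  where
  open CyclicProfile q≤n q∣h
  ψ = alternativeCycle 1

coprime-* : ∀ {m a b} → Coprime m a → Coprime m b → Coprime m (a * b)
coprime-* {m} {a} m⊥a m⊥b (d∣m , d∣ab) = m⊥b (d∣m , coprime-divisor d⊥a d∣ab)
  where
  d⊥a : Coprime _ a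
  d⊥a (e∣d , e∣a) = m⊥a (∣-trans e∣d d∣m , e∣a)

rough⇒coprime : ∀ {m k} .{{_ : NonZero k}} → suc k Rough m → Coprime m k
rough⇒coprime {k = k} rough {0} (_ , 0∣k) = contradiction (0∣⇒≡0 0∣k) (≢-nonZero⁻¹ k)
rough⇒coprime rough {1} _ = refl
rough⇒coprime rough {2+ d} (d∣m , d∣k) = contradiction (hasNonTrivialDivisor (s≤s (∣⇒≤ d∣k)) d∣m) rough

rough⇒coprime-! : ∀ {m} n → suc n Rough m → Coprime m (n !)
rough⇒coprime-! zero    rough (_ , d∣1) = ∣1⇒≡1 d∣1
rough⇒coprime-! (suc n) rough = coprime-* (rough⇒coprime rough)
  (rough⇒coprime-! n (λ divisor → rough (hasNonTrivialDivisor-≤ divisor (n≤1+n (suc n)))))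

fullSubgroup : ∀ h n → Subgroup h n
fullSubgroup h n = record
  { _∈U_ = λ _ → ⊤ ; ∈-resp = λ _ _ → tt ; ∈-id = tt ; ∈-mul = λ _ _ → tt ; ∈-inv = λ _ → tt }

proposition22 : (h n : ℕ) → 2 ≤ h → 2 ≤ n →
    ((U : Subgroup h n) → IsSymmetryGroup U) →
    gcd h (n !) ≡ 1
proposition22 (suc h′) n _ _ symmetric =
  let (Fr , G≡G[F]) = symmetric (fullSubgroup (suc h′) n) in
  coprime⇒gcd≡1 (rough⇒coprime-! n (fullSymmetry⇒rough Fr (λ g → Equivalence.to (G≡G[F] g) tt)))
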